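{- Let $(a_n)$, $(b_n)$ be sequences of integers with $a_n<b_n<a_{n+1}$ for all $n$, and assume $a_{n-1}=o(a_n)$. Let $I_n=[a_n,b_n]\cap\mathbb{Z}$, let $X_n\subset I_n$ for each $n$, and let $X=\bigcup_n X_n$. Assume that for every $\varepsilon>0$ there is $n_0$ such that for all $n\geq n_0$ and all integers $y\geq\varepsilon a_n$, $$|X_n\cap(\min X_n+([0,y)\cap\mathbb{Z}))|\leq\varepsilon y.$$ Then $X$ has natural density $0$, i.e. $\lim_{N\to\infty}|X\cap\{1,\dots,N\}|/N=0$. -}

module Defs where

open import Data.Bool using (Bool; true; false; if_then_else_)
open import Data.Nat using (ℕ; zero; suc)
import Data.Nat as ℕ
open import Data.Integer using (ℤ; +_; -[1+_]; _+_; _≤_)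
open import Data.Product using (_×_)
open import Relation.Binary.PropositionalEquality using (_≡_)

countFrom : (ℤ → Bool) → ℤ → ℕ → ℕ
countFrom P s zero    = 0
countFrom P s (suc k) = (if P s then 1 else 0) ℕ.+ countFrom P (s + + 1) k

countShift : (ℤ → Bool) → ℤ → ℤ → ℕ
countShift P m (+ k)    = countFrom P m k
countShift P m -[1+ _ ] = 0

IsMin : (ℤ → Bool) → ℤ → Set
IsMin P m = (P m ≡ true) × (∀ x → P x ≡ true → m ≤ x)

{-# OPTIONS --safe #-}
-- Take ε = 1/Q and drop finitely many blocks, so that from then on a_n ≥ 0, a_{n+1} ≥ 2 a_n
-- and the hypothesis on X_n holds; write c_n for the remaining a_n. Since min X_n ≥ a_n, every
-- window [a_n, M) meets X_n in at most M/Q points, and on [a_n, a_{n+1}) the set X is contained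
-- in X_n. Adding blocks, Q·|X ∩ [c_0, M)| ≤ 2 c_n + M whenever c_n ≤ M ≤ c_{n+1}: the step from
-- n to n+1 costs c_{n+1} for the full block [c_n, c_{n+1}), and 2 c_n + c_{n+1} ≤ 2 c_{n+1} by
-- doubling. Hence Q·|X ∩ [0, M)| ≤ Q c_0 + 3M, which is below 4M for large M; Q = 4(1+q) then
-- gives density at most 1/(1+q).
module Submission where

open import Defs
open import Data.Bool using (Bool; true; false; if_then_else_)
open import Data.Product using (_×_; ∃; _,_; proj₁; proj₂; map₂)
open import Data.Sum using (_⊎_; inj₁; inj₂)
open import Function using (_∘_)
open import Relation.Binary.PropositionalEquality
  using (_≡_; _≢_; refl; sym; trans; cong; subst; subst₂; module ≡-Reasoning)
open import Relation.Nullary using (contradiction)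

module Counting where
  open import Data.Nat using (ℕ; zero; suc; _+_; _∸_; _≤_; _<_; z≤n; s≤s; z<s)
  open import Data.Nat.Properties

  count : (ℕ → Bool) → ℕ → ℕ → ℕ
  count P i zero    = 0
  count P i (suc k) = (if P i then 1 else 0) + count P (suc i) k

  countIn : (ℕ → Bool) → ℕ → ℕ → ℕ
  countIn P i j = count P i (j ∸ i)

  count-++ : ∀ P i j k → count P i (j + k) ≡ count P i j + count P (i + j) k
  count-++ P i zero    k = cong (λ i′ → count P i′ k) (sym (+-identityʳ i))
  count-++ P i (suc j) k = begin
    b + count P (suc i) (j + k)                      ≡⟨ cong (b +_) (count-++ P (suc i) j k) ⟩
    b + (count P (suc i) j + count P (suc i + j) k)  ≡⟨ +-assoc b _ _ ⟨
    b + count P (suc i) j + count P (suc i + j) k    ≡⟨ cong (λ m → b + count P (suc i) j + count P m k) (+-suc i j) ⟨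
    count P i (suc j) + count P (i + suc j) k        ∎
    where
    open ≡-Reasoning
    b : ℕ
    b = if P i then 1 else 0

  count≤length : ∀ P i k → count P i k ≤ k
  count≤length P i zero = z≤n
  count≤length P i (suc k) with P i
  ... | true  = s≤s (count≤length P (suc i) k)
  ... | false = m≤n⇒m≤1+n (count≤length P (suc i) k)

  count-mono-length : ∀ P i {k l} → k ≤ l → count P i k ≤ count P i l
  count-mono-length P i {k} {l} k≤l = begin
    count P i k                            ≤⟨ m≤m+n _ _ ⟩
    count P i k + count P (i + k) (l ∸ k)  ≡⟨ count-++ P i k (l ∸ k) ⟨
    count P i (k + (l ∸ k))                ≡⟨ cong (count P i) (m+[n∸m]≡n k≤l) ⟩
    count P i l                            ∎
    where open ≤-Reasoning

  indicator-mono : ∀ {b c m n} → (b ≡ true → c ≡ true) → m ≤ n →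
                   (if b then 1 else 0) + m ≤ (if c then 1 else 0) + n
  indicator-mono {false} {false} _   m≤n = m≤n
  indicator-mono {false} {true}  _   m≤n = m≤n⇒m≤1+n m≤n
  indicator-mono {true}  {true}  _   m≤n = s≤s m≤n
  indicator-mono {true}  {false} b⇒c m≤n with () ← b⇒c refl

  count-mono-⊆ : ∀ {P R} i k → (∀ x → i ≤ x → x < i + k → P x ≡ true → R x ≡ true) →
                 count P i k ≤ count R i k
  count-mono-⊆ i zero    _   = z≤n
  count-mono-⊆ {P} {R} i (suc k) P⊆R =
    indicator-mono (P⊆R i ≤-refl (m<m+n i z<s)) (count-mono-⊆ (suc i) k P⊆R′)
    where
    P⊆R′ : ∀ x → suc i ≤ x → x < suc i + k → P x ≡ true → R x ≡ true
    P⊆R′ x i<x x<1+i+k = P⊆R x (<⇒≤ i<x) (subst (x <_) (sym (+-suc i k)) x<1+i+k)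

  count≡0⊎first : ∀ P i k → count P i k ≡ 0 ⊎ ∃ λ d → P (i + d) ≡ true × count P i d ≡ 0
  count≡0⊎first P i zero = inj₁ refl
  count≡0⊎first P i (suc k) with P i in Pi | count≡0⊎first P (suc i) k
  ... | true  | _         = inj₂ (0 , subst (λ x → P x ≡ true) (sym (+-identityʳ i)) Pi , refl)
  ... | false | inj₁ none = inj₁ none
  ... | false | inj₂ (d , P[1+i+d] , none) =
    inj₂ (suc d , subst (λ x → P x ≡ true) (sym (+-suc i d)) P[1+i+d] ,
          trans (cong (λ b → (if b then 1 else 0) + count P (suc i) d) Pi) none)

  count≡0⇒¬P : ∀ P {i k x} → count P i k ≡ 0 → i ≤ x → x < i + k → P x ≢ true
  count≡0⇒¬P P {i} {zero}  {x} _    i≤x x<i+0   _  = ≤⇒≯ i≤x (subst (x <_) (+-identityʳ i) x<i+0)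
  count≡0⇒¬P P {i} {suc k} {x} none i≤x x<i+1+k Px with P i in Pi | m≤n⇒m<n∨m≡n i≤x
  ... | true  | _         = 1+n≢0 none
  ... | false | inj₁ i<x  = count≡0⇒¬P P none i<x (subst (x <_) (+-suc i k) x<i+1+k) Px
  ... | false | inj₂ refl = contradiction (trans (sym Px) Pi) λ ()

  count-skip : ∀ P i d k → count P i d ≡ 0 → count P i k ≤ count P (i + d) k
  count-skip P i d k none = begin
    count P i k                      ≤⟨ count-mono-length P i (m≤n+m k d) ⟩
    count P i (d + k)                ≡⟨ count-++ P i d k ⟩
    count P i d + count P (i + d) k  ≡⟨ cong (_+ count P (i + d) k) none ⟩
    count P (i + d) k                ∎
    where open ≤-Reasoning

  countIn-split : ∀ P {i j k} → i ≤ j → j ≤ k → countIn P i k ≡ countIn P i j + countIn P j k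
  countIn-split P {i} {j} {k} i≤j j≤k = begin
    count P i (k ∸ i)                                  ≡⟨ cong (λ m → count P i (m ∸ i)) (m+[n∸m]≡n j≤k) ⟨
    count P i (j + (k ∸ j) ∸ i)                        ≡⟨ cong (count P i) (+-∸-comm (k ∸ j) i≤j) ⟩
    count P i (j ∸ i + (k ∸ j))                        ≡⟨ count-++ P i (j ∸ i) (k ∸ j) ⟩
    count P i (j ∸ i) + count P (i + (j ∸ i)) (k ∸ j)  ≡⟨ cong (λ m → count P i (j ∸ i) + count P m (k ∸ j))
                                                              (m+[n∸m]≡n i≤j) ⟩
    count P i (j ∸ i) + count P j (k ∸ j)              ∎
    where open ≡-Reasoning

module Sequences where
  open import Data.Nat using (ℕ; zero; suc; _≤_; _<_; _⊔_; z≤n; _≤′_; ≤′-refl; ≤′-step)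
  open import Data.Nat.Properties
    using (m⊔n≤o⇒m≤o; m⊔n≤o⇒n≤o; ≤⇒≤′; ≤-pred; m≤n⇒m<n∨m≡n; m≤n⇒m≤1+n; n≤1+n; <⇒≤)
  open import Relation.Binary.Bundles using (Preorder)

  Eventually : (ℕ → Set) → Set
  Eventually P = ∃ λ n₀ → ∀ n → n₀ ≤ n → P n

  eventually-× : ∀ {P R} → Eventually P → Eventually R → Eventually (λ n → P n × R n)
  eventually-× (m , p) (n , r) =
    m ⊔ n , λ k m⊔n≤k → p k (m⊔n≤o⇒m≤o m n m⊔n≤k) , r k (m⊔n≤o⇒n≤o m n m⊔n≤k)

  module _ {c ℓ₁ ℓ₂} (≲-preorder : Preorder c ℓ₁ ℓ₂) where
    open Preorder ≲-preorder using (Carrier; _≲_) renaming (refl to ≲-refl; trans to ≲-trans)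

    steps⇒mono : (f : ℕ → Carrier) → (∀ n → f n ≲ f (suc n)) → ∀ {i j} → i ≤ j → f i ≲ f j
    steps⇒mono f step {i} i≤j = go (≤⇒≤′ i≤j)
      where
      go : ∀ {j} → i ≤′ j → f i ≲ f j
      go ≤′-refl      = ≲-refl
      go (≤′-step i≤j) = ≲-trans (go i≤j) (step _)

  block-containing : ∀ {c : ℕ → ℕ} → (∀ n → c n < c (suc n)) →
                     ∀ M → c 0 ≤ M → ∃ λ n → c n ≤ M × M ≤ c (suc n)
  block-containing {c} c-increasing zero    c₀≤0 = 0 , c₀≤0 , z≤n
  block-containing {c} c-increasing (suc M) c₀≤1+M with m≤n⇒m<n∨m≡n c₀≤1+M
  ... | inj₂ c₀≡1+M = 0 , c₀≤1+M , subst (_≤ c 1) c₀≡1+M (<⇒≤ (c-increasing 0))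
  ... | inj₁ c₀<1+M with block-containing c-increasing M (≤-pred c₀<1+M)
  ...   | n , cₙ≤M , M≤cₙ₊₁ with m≤n⇒m<n∨m≡n M≤cₙ₊₁
  ...     | inj₁ M<cₙ₊₁ = n , m≤n⇒m≤1+n cₙ≤M , M<cₙ₊₁
  ...     | inj₂ refl   = suc n , n≤1+n _ , c-increasing (suc n)

module BlockDensity where
  open import Data.Nat using (ℕ; zero; suc; _+_; _*_; _≤_; _<_; z≤n)
  open import Data.Nat.Properties
  open Counting
  open Sequences

  module _ {P : ℕ → Bool} {Q : ℕ} {c : ℕ → ℕ}
      (c-increasing : ∀ n → c n < c (suc n))
      (c-doubling : ∀ n → 2 * c n ≤ c (suc n))
      (block-sparse : ∀ n M → c n ≤ M → M ≤ c (suc n) → Q * countIn P (c n) M ≤ M) where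

    c-mono : ∀ {i j} → i ≤ j → c i ≤ c j
    c-mono = steps⇒mono ≤-preorder c (λ n → <⇒≤ (c-increasing n))

    sparse-up-to-block : ∀ n M → c n ≤ M → M ≤ c (suc n) → Q * countIn P (c 0) M ≤ 2 * c n + M
    sparse-up-to-block zero    M c₀≤M M≤c₁ = ≤-trans (block-sparse 0 M c₀≤M M≤c₁) (m≤n+m M _)
    sparse-up-to-block (suc n) M cₙ₊₁≤M M≤cₙ₊₂ = begin
      Q * countIn P (c 0) M
        ≡⟨ cong (Q *_) (countIn-split P (c-mono z≤n) cₙ₊₁≤M) ⟩
      Q * (countIn P (c 0) c′ + countIn P c′ M)
        ≡⟨ *-distribˡ-+ Q _ _ ⟩
      Q * countIn P (c 0) c′ + Q * countIn P c′ M
        ≤⟨ +-mono-≤ (sparse-up-to-block n c′ (<⇒≤ (c-increasing n)) ≤-refl)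
                    (block-sparse (suc n) M cₙ₊₁≤M M≤cₙ₊₂) ⟩
      2 * c n + c′ + M
        ≤⟨ +-monoˡ-≤ M (+-monoˡ-≤ c′ (c-doubling n)) ⟩
      c′ + c′ + M
        ≡⟨ cong (λ m → c′ + m + M) (+-identityʳ c′) ⟨
      2 * c′ + M
        ∎
      where
      open ≤-Reasoning
      c′ : ℕ
      c′ = c (suc n)

    sparse-from-c₀ : ∀ M → c 0 ≤ M → Q * countIn P (c 0) M ≤ 3 * M
    sparse-from-c₀ M c₀≤M with block-containing c-increasing M c₀≤M
    ... | n , cₙ≤M , M≤cₙ₊₁ = begin
      Q * countIn P (c 0) M  ≤⟨ sparse-up-to-block n M cₙ≤M M≤cₙ₊₁ ⟩
      2 * c n + M            ≤⟨ +-monoˡ-≤ M (*-monoʳ-≤ 2 cₙ≤M) ⟩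
      2 * M + M              ≡⟨ +-comm (2 * M) M ⟩
      3 * M                  ∎
      where open ≤-Reasoning

    sparse-from-0 : ∀ M → c 0 ≤ M → Q * countIn P 0 M ≤ Q * c 0 + 3 * M
    sparse-from-0 M c₀≤M = begin
      Q * countIn P 0 M                                ≡⟨ cong (Q *_) (countIn-split P z≤n c₀≤M) ⟩
      Q * (countIn P 0 (c 0) + countIn P (c 0) M)      ≡⟨ *-distribˡ-+ Q _ _ ⟩
      Q * countIn P 0 (c 0) + Q * countIn P (c 0) M    ≤⟨ +-mono-≤ (*-monoʳ-≤ Q (count≤length P 0 (c 0)))
                                                                     (sparse-from-c₀ M c₀≤M) ⟩
      Q * c 0 + 3 * M                                  ∎
      where open ≤-Reasoning

module IntegerBlocks where
  open import Data.Nat using (ℕ; zero; suc; _+_; _*_; _∸_; _≤_; _<_; z≤n; NonZero)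
  open import Data.Nat.Properties
  open import Relation.Binary.Definitions using (tri<; tri≈; tri>)
  open import Data.Integer as ℤ using (ℤ; +_; -[1+_]; 0ℤ; ∣_∣; +≤+; +<+) renaming (suc to sucℤ)
  import Data.Integer.Properties as ℤP
  open Counting
  open Sequences
  open BlockDensity

  countFrom≡count : ∀ P i k → countFrom P (+ i) k ≡ count (P ∘ +_) i k
  countFrom≡count P i zero    = refl
  countFrom≡count P i (suc k) = cong (λ n → (if P (+ i) then 1 else 0) + n)
    (trans (countFrom≡count P (i + 1) k) (cong (λ j → count (P ∘ +_) j k) (+-comm i 1)))

  module _ {a : ℕ → ℤ} (a-increasing : ∀ n → a n ℤ.< a (suc n)) where

    increasing⇒mono : ∀ {i j} → i ≤ j → a i ℤ.≤ a j
    increasing⇒mono = steps⇒mono ℤP.≤-preorder a (ℤP.<⇒≤ ∘ a-increasing)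

    suc-below : ∀ {i n} → i ℤ.≤ a n → sucℤ i ℤ.≤ a (suc n)
    suc-below {n = n} i≤aₙ = ℤP.≤-trans (ℤP.suc-mono i≤aₙ) (ℤP.i<j⇒suc[i]≤j (a-increasing n))

    -- sucℤ -[1+ suc m ] reduces to -[1+ m ], and sucℤ -[1+ 0 ] to 0ℤ.
    climb : ∀ m n → -[1+ m ] ℤ.≤ a n → ∃ λ k → 0ℤ ℤ.≤ a k
    climb zero    n h = suc n , suc-below h
    climb (suc m) n h = climb m (suc n) (suc-below h)

    somewhere-nonneg : ∃ λ k → 0ℤ ℤ.≤ a k
    somewhere-nonneg with a 0 in a₀
    ... | + _      = 0 , subst (0ℤ ℤ.≤_) (sym a₀) (+≤+ z≤n)
    ... | -[1+ m ] = climb m 0 (ℤP.≤-reflexive (sym a₀))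

    increasing⇒eventually-nonneg : Eventually (λ n → 0ℤ ℤ.≤ a n)
    increasing⇒eventually-nonneg =
      map₂ (λ 0≤aₖ n k≤n → ℤP.≤-trans 0≤aₖ (increasing⇒mono k≤n)) somewhere-nonneg

  interlaced⇒increasing : ∀ {a b : ℕ → ℤ} → (∀ n → (a n ℤ.< b n) × (b n ℤ.< a (suc n))) →
                          ∀ n → a n ℤ.< a (suc n)
  interlaced⇒increasing a<b<a n = ℤP.<-trans (proj₁ (a<b<a n)) (proj₂ (a<b<a n))

  -- The paper's hypothesis on X_n for ε = 1/Q, with lo = a_n.
  SparseFromMin : ℕ → (ℤ → Bool) → ℤ → Set
  SparseFromMin Q P lo =
    ∀ y → + 1 ℤ.* lo ℤ.≤ + Q ℤ.* y → ∀ m → IsMin P m → + Q ℤ.* + countShift P m y ℤ.≤ + 1 ℤ.* y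

  -- A window starting at i holds no more of P than the window of the same length starting at the
  -- first element of P, and that element is min P because P lies above i.
  sparse-window : ∀ {P Q} i .{{_ : NonZero Q}} → (∀ x → P x ≡ true → + i ℤ.≤ x) →
                  SparseFromMin Q P (+ i) → ∀ M → i ≤ M → Q * countIn (P ∘ +_) i M ≤ M
  sparse-window {P} {Q} i P≥i sparse M i≤M with count≡0⊎first (P ∘ +_) i (M ∸ i)
  ... | inj₁ none = ≤-trans (≤-reflexive (trans (cong (Q *_) none) (*-zeroʳ Q))) z≤n
  ... | inj₂ (d , P[i+d] , none) = begin
    Q * count (P ∘ +_) i (M ∸ i)        ≤⟨ *-monoʳ-≤ Q (count-skip (P ∘ +_) i d (M ∸ i) none) ⟩
    Q * count (P ∘ +_) (i + d) (M ∸ i)  ≤⟨ *-monoʳ-≤ Q (count-mono-length (P ∘ +_) (i + d) (m∸n≤m M i)) ⟩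
    Q * count (P ∘ +_) (i + d) M        ≡⟨ cong (Q *_) (countFrom≡count P (i + d) M) ⟨
    Q * countShift P (+ (i + d)) (+ M)  ≤⟨ drop-+ (sparse (+ M) i≤QM (+ (i + d)) (P[i+d] , minimal)) ⟩
    M                                   ∎
    where
    open ≤-Reasoning
    i≤QM : + 1 ℤ.* + i ℤ.≤ + Q ℤ.* + M
    i≤QM = subst₂ ℤ._≤_ (sym (ℤP.*-identityˡ (+ i))) (ℤP.pos-* Q M) (+≤+ (≤-trans i≤M (m≤n*m M Q)))
    minimal : ∀ x → P x ≡ true → + (i + d) ℤ.≤ x
    minimal (+ u)    Pu =
      +≤+ (≮⇒≥ λ u<i+d → count≡0⇒¬P (P ∘ +_) none (ℤP.drop‿+≤+ (P≥i (+ u) Pu)) u<i+d Pu)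
    minimal -[1+ u ] Pu with () ← P≥i -[1+ u ] Pu
    drop-+ : ∀ {n} → + Q ℤ.* + n ℤ.≤ + 1 ℤ.* + M → Q * n ≤ M
    drop-+ {n} h = ℤP.drop‿+≤+ (subst₂ ℤ._≤_ (sym (ℤP.pos-* Q n)) (ℤP.*-identityˡ (+ M)) h)

  module _ (a b : ℕ → ℤ) (a<b<a : ∀ n → (a n ℤ.< b n) × (b n ℤ.< a (suc n)))
           (Xs : ℕ → ℤ → Bool) (Xs⊆[a,b] : ∀ n x → Xs n x ≡ true → (a n ℤ.≤ x) × (x ℤ.≤ b n))
           (X : ℤ → Bool) (X⊆⋃Xs : ∀ x → X x ≡ true → ∃ λ n → Xs n x ≡ true) where

    a-increasing : ∀ n → a n ℤ.< a (suc n)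
    a-increasing = interlaced⇒increasing a<b<a

    X∩block⊆Xs : ∀ k x → a k ℤ.≤ x → x ℤ.< a (suc k) → X x ≡ true → Xs k x ≡ true
    X∩block⊆Xs k x aₖ≤x x<aₖ₊₁ Xx with X⊆⋃Xs x Xx
    ... | j , Xsⱼx with <-cmp j k | Xs⊆[a,b] j x Xsⱼx
    ...   | tri< j<k _ _ | _ , x≤bⱼ =
      contradiction (ℤP.≤-trans (increasing⇒mono a-increasing j<k) aₖ≤x)
                    (ℤP.<⇒≱ (ℤP.≤-<-trans x≤bⱼ (proj₂ (a<b<a j))))
    ...   | tri≈ _ refl _ | _ = Xsⱼx
    ...   | tri> _ _ k<j | aⱼ≤x , _ =
      contradiction (ℤP.≤-trans (increasing⇒mono a-increasing k<j) aⱼ≤x) (ℤP.<⇒≱ x<aₖ₊₁)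

    module _ (Q : ℕ) .{{_ : NonZero Q}} (K : ℕ)
             (from-K : ∀ n → K ≤ n →
                0ℤ ℤ.≤ a n × 2 * ∣ a n ∣ ≤ 1 * ∣ a (suc n) ∣ × SparseFromMin Q (Xs n) (a n)) where

      c : ℕ → ℕ
      c n = ∣ a (n + K) ∣

      from-K+ : ∀ n → 0ℤ ℤ.≤ a (n + K) × 2 * c n ≤ 1 * c (suc n) × SparseFromMin Q (Xs (n + K)) (a (n + K))
      from-K+ n = from-K (n + K) (m≤n+m K n)

      +c≡a : ∀ n → + c n ≡ a (n + K)
      +c≡a n = ℤP.0≤i⇒+∣i∣≡i (proj₁ (from-K+ n))

      c-increasing : ∀ n → c n < c (suc n)
      c-increasing n =
        ℤP.drop‿+<+ (subst₂ ℤ._<_ (sym (+c≡a n)) (sym (+c≡a (suc n))) (a-increasing (n + K)))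

      c-doubling : ∀ n → 2 * c n ≤ c (suc n)
      c-doubling n = subst (2 * c n ≤_) (*-identityˡ (c (suc n))) (proj₁ (proj₂ (from-K+ n)))

      c-block-sparse : ∀ n M → c n ≤ M → M ≤ c (suc n) → Q * countIn (X ∘ +_) (c n) M ≤ M
      c-block-sparse n M cₙ≤M M≤cₙ₊₁ = begin
        Q * countIn (X ∘ +_) (c n) M               ≤⟨ *-monoʳ-≤ Q (count-mono-⊆ (c n) (M ∸ c n) X⊆Xsₖ) ⟩
        Q * countIn (Xs (n + K) ∘ +_) (c n) M      ≤⟨ sparse-window (c n) Xsₖ≥cₙ sparseₖ M cₙ≤M ⟩
        M                                          ∎
        where
        open ≤-Reasoning
        X⊆Xsₖ : ∀ x → c n ≤ x → x < c n + (M ∸ c n) → X (+ x) ≡ true → Xs (n + K) (+ x) ≡ true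
        X⊆Xsₖ x cₙ≤x x<M = X∩block⊆Xs (n + K) (+ x) (subst (ℤ._≤ + x) (+c≡a n) (+≤+ cₙ≤x))
          (subst (+ x ℤ.<_) (+c≡a (suc n)) (+<+ (<-≤-trans (subst (x <_) (m+[n∸m]≡n cₙ≤M) x<M) M≤cₙ₊₁)))
        Xsₖ≥cₙ : ∀ x → Xs (n + K) x ≡ true → + c n ℤ.≤ x
        Xsₖ≥cₙ x Xsₖx = subst (ℤ._≤ x) (sym (+c≡a n)) (proj₁ (Xs⊆[a,b] (n + K) x Xsₖx))
        sparseₖ : SparseFromMin Q (Xs (n + K)) (+ c n)
        sparseₖ = subst (SparseFromMin Q (Xs (n + K))) (sym (+c≡a n)) (proj₂ (proj₂ (from-K+ n)))

      density-bound : ∀ N → Q * c 0 + 3 ≤ N → Q * countFrom X (+ 1) N ≤ 4 * N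
      density-bound N N₀≤N = begin
        Q * countFrom X (+ 1) N            ≤⟨ *-monoʳ-≤ Q X[1,N]≤X[0,N] ⟩
        Q * countIn (X ∘ +_) 0 (suc N)     ≤⟨ sparse-from-0 {P = X ∘ +_} {Q = Q} c-increasing c-doubling c-block-sparse
                                                            (suc N) c₀≤1+N ⟩
        Q * c 0 + 3 * suc N                ≡⟨ cong (_+_ (Q * c 0)) (*-suc 3 N) ⟩
        Q * c 0 + (3 + 3 * N)              ≡⟨ +-assoc (Q * c 0) 3 (3 * N) ⟨
        Q * c 0 + 3 + 3 * N                ≤⟨ +-monoˡ-≤ (3 * N) N₀≤N ⟩
        4 * N                              ∎
        where
        open ≤-Reasoning
        X[1,N]≤X[0,N] : countFrom X (+ 1) N ≤ countIn (X ∘ +_) 0 (suc N)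
        X[1,N]≤X[0,N] = subst (_≤ countIn (X ∘ +_) 0 (suc N)) (sym (countFrom≡count X 1 N)) (m≤n+m _ _)
        c₀≤1+N : c 0 ≤ suc N
        c₀≤1+N = ≤-trans (m≤n*m (c 0) Q) (≤-trans (m≤m+n _ 3) (≤-trans N₀≤N (n≤1+n N)))

      X-density : Eventually (λ N → Q * countFrom X (+ 1) N ≤ 4 * N)
      X-density = Q * c 0 + 3 , density-bound

-- Integer operators are opened unqualified only now, so that they do not clash with ℕ's above.
open import Data.Nat using (ℕ; suc)
import Data.Nat as ℕ
import Data.Nat.Properties as ℕP
open import Data.Integer using (ℤ; +_; 0ℤ; _≤_; _<_; _*_; ∣_∣)
open Sequences using (Eventually; eventually-×)
open IntegerBlocks using (SparseFromMin; interlaced⇒increasing; increasing⇒eventually-nonneg; X-density)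

lemma2p2 : (a b : ℕ → ℤ)
    → (∀ n → (a n < b n) × (b n < a (suc n)))
    → (∀ (p q : ℕ) → 0 ℕ.< p → 0 ℕ.< q → ∃ λ n₀ → ∀ n → n₀ ℕ.≤ n → q ℕ.* ∣ a n ∣ ℕ.≤ p ℕ.* ∣ a (suc n) ∣)
    → (Xs : ℕ → ℤ → Bool)
    → (∀ n x → Xs n x ≡ true → (a n ≤ x) × (x ≤ b n))
    → (X : ℤ → Bool)
    → (∀ x → (X x ≡ true → ∃ λ n → Xs n x ≡ true) × (∀ n → Xs n x ≡ true → X x ≡ true))
    → (∀ (p q : ℕ) → 0 ℕ.< p → 0 ℕ.< q → ∃ λ n₀ → ∀ n → n₀ ℕ.≤ n → ∀ (y : ℤ) → + p * a n ≤ + q * y → ∀ m → IsMin (Xs n) m → + q * + countShift (Xs n) m y ≤ + p * y)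
    → ∀ (p q : ℕ) → 0 ℕ.< p → 0 ℕ.< q → ∃ λ N₀ → ∀ N → N₀ ℕ.≤ N → q ℕ.* countFrom X (+ 1) N ℕ.≤ p ℕ.* N
lemma2p2 a b a<b<a growth Xs Xs⊆[a,b] X X≡⋃Xs sparse (suc p) (suc q) _ _ =
  map₂ (λ bound N N₀≤N → cancel (bound N N₀≤N)) density
  where
  Q : ℕ
  Q = 4 ℕ.* suc q

  eventually : Eventually (λ n → 0ℤ ≤ a n × 2 ℕ.* ∣ a n ∣ ℕ.≤ 1 ℕ.* ∣ a (suc n) ∣ ×
                                 SparseFromMin Q (Xs n) (a n))
  eventually = eventually-× (increasing⇒eventually-nonneg (interlaced⇒increasing a<b<a))
                 (eventually-× (growth 1 2 ℕ.z<s ℕ.z<s) (sparse 1 Q ℕ.z<s ℕ.z<s))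

  density : Eventually (λ N → Q ℕ.* countFrom X (+ 1) N ℕ.≤ 4 ℕ.* N)
  density = X-density a b a<b<a Xs Xs⊆[a,b] X (proj₁ ∘ X≡⋃Xs) Q (proj₁ eventually) (proj₂ eventually)

  cancel : ∀ {x N} → Q ℕ.* x ℕ.≤ 4 ℕ.* N → suc q ℕ.* x ℕ.≤ suc p ℕ.* N
  cancel {x} {N} Qx≤4N = ℕP.≤-trans (ℕP.*-cancelˡ-≤ 4 (subst (ℕ._≤ 4 ℕ.* N) (ℕP.*-assoc 4 (suc q) x) Qx≤4N))
                                    (ℕP.m≤n*m N (suc p))
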